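{- Let $G$ be a connected split graph, let $C$ be a maximum clique of $G$ such that $I=V(G)\setminus C$ is an independent set. If $D$ is a minimal convex dominating set of $G$, then $D\subseteq C$. -}

module Defs where

open import Data.Nat using (ℕ; zero; suc; _≤_; _<_)
open import Data.Fin using (Fin)
open import Data.Fin.Subset using (Subset; _∈_; _∉_; _⊆_; _⊂_; ∣_∣; ∁)
open import Data.Product using (Σ; ∃; ∃-syntax; _×_; _,_)
open import Data.Sum using (_⊎_)
open import Relation.Nullary using (¬_)
open import Relation.Binary.PropositionalEquality using (_≡_; _≢_)

record Graph (n : ℕ) : Set₁ where
  field
    Adj     : Fin n → Fin n → Set
    sym     : ∀ {u v} → Adj u v → Adj v u
    irrefl  : ∀ {u} → ¬ Adj u u

module _ {n : ℕ} (G : Graph n) where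
  open Graph G

  data Walk : Fin n → Fin n → Set where
    [_]  : (u : Fin n) → Walk u u
    _∷_ : ∀ {u v w} → Adj u v → Walk v w → Walk u w

  len : ∀ {u v} → Walk u v → ℕ
  len [ _ ]     = zero
  len (_ ∷ p)   = suc (len p)

  data OnWalk (x : Fin n) : ∀ {u v} → Walk u v → Set where
    here-end : OnWalk x [ x ]
    here     : ∀ {v w} (e : Adj x v) (p : Walk v w) → OnWalk x (e ∷ p)
    there    : ∀ {u v w} (e : Adj u v) {p : Walk v w} → OnWalk x p → OnWalk x (e ∷ p)

  Connected : Set
  Connected = ∀ u v → Walk u v

  IsGeodesic : ∀ {u v} → Walk u v → Set
  IsGeodesic {u} {v} p = ∀ (q : Walk u v) → len p ≤ len q

  IsClique : Subset n → Set
  IsClique C = ∀ {u v} → u ∈ C → v ∈ C → u ≢ v → Adj u v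

  IsMaximumClique : Subset n → Set
  IsMaximumClique C = IsClique C × (∀ C′ → IsClique C′ → ∣ C′ ∣ ≤ ∣ C ∣)

  IsIndependent : Subset n → Set
  IsIndependent I = ∀ {u v} → u ∈ I → v ∈ I → ¬ Adj u v

  IsSplit : Set
  IsSplit = ∃[ K ] (IsClique K × IsIndependent (∁ K))

  IsConvex : Subset n → Set
  IsConvex D = ∀ {u v} → u ∈ D → v ∈ D → (p : Walk u v) → IsGeodesic p →
               ∀ {x} → OnWalk x p → x ∈ D

  IsDominating : Subset n → Set
  IsDominating D = ∀ v → v ∈ D ⊎ ∃[ u ] (u ∈ D × Adj v u)

  IsConvexDominating : Subset n → Set
  IsConvexDominating D = IsConvex D × IsDominating D

  IsMinimalConvexDominating : Subset n → Set
  IsMinimalConvexDominating D =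
    IsConvexDominating D × (∀ D′ → D′ ⊂ D → ¬ IsConvexDominating D′)

-- Let w ∈ D \ C. Since C is a maximum clique, some c ∈ C is not adjacent to w,
-- and every neighbour x of w lies in C. Either c ∈ D, or c is dominated by some
-- u ∈ D; in both cases w x c (or w x c u) is a walk of length at most 3 from w
-- to a vertex of D, and convexity of D forces a neighbour of w into D ∩ C.
-- Hence D ∩ C dominates G; being a clique it is convex, contradicting minimality.
-- Adjacency is not decidable, so the argument runs in the double-negation monad,
-- which suffices because membership in C is decidable.
module Submission where

open import Defs
open import Level using (0ℓ)
open import Data.Nat using (ℕ; zero; suc; _≤_; z≤n; s≤s)
open import Data.Nat.Properties using (≤-trans; ≤-refl; m≤n⇒m≤1+n; <⇒≱)
open import Data.Fin using (Fin; zero; suc; _≟_)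
open import Data.Fin.Properties using (∀-cons)
open import Data.Fin.Subset using (Subset; _∈_; _∉_; _⊆_; _⊂_; _∩_; _∪_; ⁅_⁆; ∁)
open import Data.Fin.Subset.Properties
  using (_∈?_; x∈p∩q⁺; x∈p∩q⁻; p∩q⊆p; p∩q⊆q; p⊆p∪q; q⊆p∪q; x∈p∪q⁻; x∈⁅x⁆; x∈⁅y⁆⇒x≡y;
         p⊂q⇒∣p∣<∣q∣; x∉p⇒x∈∁p)
open import Data.Product using (∃-syntax; _×_; _,_; proj₁; proj₂)
open import Data.Sum using (_⊎_; inj₁; inj₂)
open import Data.Empty using (⊥-elim)
open import Effect.Monad using (RawMonad)
open import Relation.Nullary using (¬_; Dec; yes; no)
open import Relation.Nullary.Negation using (DoubleNegation; ¬¬-Monad)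
open import Relation.Nullary.Decidable using (¬¬-excluded-middle)
open import Relation.Binary.PropositionalEquality using (_≡_; _≢_; refl; sym; trans; subst)

open RawMonad (¬¬-Monad {0ℓ})

¬¬-∀-Fin : ∀ {n} {P : Fin n → Set} → (∀ i → DoubleNegation (P i)) →
           DoubleNegation (∀ i → P i)
¬¬-∀-Fin {zero}  _   = return λ ()
¬¬-∀-Fin {suc n} ¬¬P = do
  p₀ ← ¬¬P zero
  ps ← ¬¬-∀-Fin (λ i → ¬¬P (suc i))
  return (∀-cons p₀ ps)

module _ {n : ℕ} (G : Graph n) where
  open Graph G renaming (sym to Adj-sym)

  DistanceAtLeast : ℕ → Fin n → Fin n → Set
  DistanceAtLeast k u v = (q : Walk G u v) → k ≤ len G q

  distance≥2 : ∀ {u v} → u ≢ v → ¬ Adj u v → DistanceAtLeast 2 u v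
  distance≥2 u≢v ¬uv [ _ ]         = ⊥-elim (u≢v refl)
  distance≥2 u≢v ¬uv (uv ∷ [ _ ])  = ⊥-elim (¬uv uv)
  distance≥2 u≢v ¬uv (_ ∷ (_ ∷ _)) = s≤s (s≤s z≤n)

  distance≥3 : ∀ {u v} → u ≢ v → ¬ Adj u v → ¬ (∃[ y ] (Adj u y × Adj y v)) →
               DistanceAtLeast 3 u v
  distance≥3 u≢v ¬uv ¬uyv [ _ ]               = ⊥-elim (u≢v refl)
  distance≥3 u≢v ¬uv ¬uyv (uv ∷ [ _ ])        = ⊥-elim (¬uv uv)
  distance≥3 u≢v ¬uv ¬uyv (uy ∷ (yv ∷ [ _ ])) = ⊥-elim (¬uyv (_ , uy , yv))
  distance≥3 u≢v ¬uv ¬uyv (_ ∷ (_ ∷ (_ ∷ _))) = s≤s (s≤s (s≤s z≤n))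

  walk-≤-distance⇒geodesic : ∀ {k u v} → DistanceAtLeast k u v →
                             (p : Walk G u v) → len G p ≤ k → IsGeodesic G p
  walk-≤-distance⇒geodesic d p p≤k q = ≤-trans p≤k (d q)

  onWalk-start : ∀ {u v} (p : Walk G u v) → OnWalk G u p
  onWalk-start [ u ]   = here-end
  onWalk-start (e ∷ p) = here e p

  onWalk-≤1⇒endpoint : ∀ {x u v} (p : Walk G u v) → len G p ≤ 1 →
                       OnWalk G x p → x ≡ u ⊎ x ≡ v
  onWalk-≤1⇒endpoint [ _ ]         _        here-end           = inj₁ refl
  onWalk-≤1⇒endpoint (_ ∷ [ _ ])   _        (here _ _)         = inj₁ refl
  onWalk-≤1⇒endpoint (_ ∷ [ _ ])   _        (there _ here-end) = inj₂ refl
  onWalk-≤1⇒endpoint (_ ∷ (_ ∷ _)) (s≤s ()) _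

  walk⇒neighbour : ∀ {u v} → u ≢ v → Walk G u v → ∃[ x ] Adj u x
  walk⇒neighbour u≢v [ _ ]   = ⊥-elim (u≢v refl)
  walk⇒neighbour u≢v (e ∷ _) = _ , e

  clique-⊆ : ∀ {K L} → L ⊆ K → IsClique G K → IsClique G L
  clique-⊆ L⊆K clq u∈L v∈L = clq (L⊆K u∈L) (L⊆K v∈L)

  clique⇒convex : ∀ {K} → IsClique G K → IsConvex G K
  clique⇒convex clq {u} {v} u∈K v∈K p geo on
    with onWalk-≤1⇒endpoint p (length≤1 (u ≟ v)) on
    where
    length≤1 : Dec (u ≡ v) → len G p ≤ 1
    length≤1 (yes refl) = m≤n⇒m≤1+n (geo [ u ])
    length≤1 (no u≢v)   = geo (clq u∈K v∈K u≢v ∷ [ v ])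
  ... | inj₁ refl = u∈K
  ... | inj₂ refl = v∈K

  clique-∪-⁅⁆ : ∀ {K w} → IsClique G K → (∀ c → c ∈ K → Adj w c) →
                IsClique G (K ∪ ⁅ w ⁆)
  clique-∪-⁅⁆ {K} {w} clq w~K {a} {b} a∈ b∈ a≢b
    with x∈p∪q⁻ K ⁅ w ⁆ a∈ | x∈p∪q⁻ K ⁅ w ⁆ b∈
  ... | inj₁ a∈K | inj₁ b∈K = clq a∈K b∈K a≢b
  ... | inj₁ a∈K | inj₂ b∈w with refl ← x∈⁅y⁆⇒x≡y w b∈w = Adj-sym (w~K a a∈K)
  ... | inj₂ a∈w | inj₁ b∈K with refl ← x∈⁅y⁆⇒x≡y w a∈w = w~K b b∈K
  ... | inj₂ a∈w | inj₂ b∈w = ⊥-elim (a≢b (trans (x∈⁅y⁆⇒x≡y w a∈w) (sym (x∈⁅y⁆⇒x≡y w b∈w))))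

  maximumClique⇒nonNeighbour : ∀ {K w} → IsMaximumClique G K → w ∉ K →
                               DoubleNegation (∃[ c ] (c ∈ K × ¬ Adj w c))
  maximumClique⇒nonNeighbour {K} {w} (clq , maximum) w∉K ¬nonNeighbour =
    ¬¬-∀-Fin adjacentIfMember notAllAdjacent
    where
    adjacentIfMember : ∀ c → DoubleNegation (c ∈ K → Adj w c)
    adjacentIfMember c ¬adj =
      ¬adj λ c∈K → ⊥-elim (¬nonNeighbour (c , c∈K , λ wc → ¬adj λ _ → wc))
    notAllAdjacent : ¬ (∀ c → c ∈ K → Adj w c)
    notAllAdjacent w~K = <⇒≱ (p⊂q⇒∣p∣<∣q∣ K⊂K∪w) (maximum _ (clique-∪-⁅⁆ clq w~K))
      where
      K⊂K∪w : K ⊂ K ∪ ⁅ w ⁆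
      K⊂K∪w = p⊆p∪q ⁅ w ⁆ , w , q⊆p∪q K ⁅ w ⁆ (x∈⁅x⁆ w) , w∉K

  -- The walk only bounds the distance from u to v; the neighbour found need not lie on it.
  convex⇒neighbour-toward : ∀ {D u v} → IsConvex G D → u ∈ D → v ∈ D → u ≢ v →
                            (p : Walk G u v) → len G p ≤ 3 →
                            DoubleNegation (∃[ y ] (y ∈ D × Adj u y))
  convex⇒neighbour-toward {D} {u} {v} cvx u∈D v∈D u≢v p p≤3 = do
    no ¬uv ← ¬¬-excluded-middle
      where yes uv → return (v , v∈D , uv)
    no ¬uyv ← ¬¬-excluded-middle
      where yes (y , uy , yv) →
              let uyv-geodesic = walk-≤-distance⇒geodesic (distance≥2 u≢v ¬uv)
                                                          (uy ∷ (yv ∷ [ v ])) ≤-refl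
              in return (y , stepInD uy (yv ∷ [ v ]) uyv-geodesic , uy)
    let p-geodesic = walk-≤-distance⇒geodesic (distance≥3 u≢v ¬uv ¬uyv) p p≤3
    return (firstStep p p-geodesic)
    where
    stepInD : ∀ {y} (uy : Adj u y) (q : Walk G y v) → IsGeodesic G (uy ∷ q) → y ∈ D
    stepInD uy q geo = cvx u∈D v∈D (uy ∷ q) geo (there uy (onWalk-start q))
    firstStep : (q : Walk G u v) → IsGeodesic G q → ∃[ y ] (y ∈ D × Adj u y)
    firstStep [ _ ]    _   = ⊥-elim (u≢v refl)
    firstStep (uy ∷ q) geo = _ , stepInD uy q geo , uy

  module _ {C : Subset n} (independent : IsIndependent G (∁ C)) where

    ∉C-neighbour⇒∈C : ∀ {w x} → w ∉ C → Adj w x → x ∈ C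
    ∉C-neighbour⇒∈C {w} {x} w∉C wx with x ∈? C
    ... | yes x∈C = x∈C
    ... | no  x∉C = ⊥-elim (independent (x∉p⇒x∈∁p w∉C) (x∉p⇒x∈∁p x∉C) wx)

    module _ (connected : Connected G) (maximum : IsMaximumClique G C)
             {D : Subset n} (convex : IsConvex G D) (dominating : IsDominating G D) where

      ∈D∉C⇒neighbour∈D : ∀ {w} → w ∈ D → w ∉ C →
                         DoubleNegation (∃[ x ] (x ∈ D × Adj w x))
      ∈D∉C⇒neighbour∈D {w} w∈D w∉C = do
        (c , c∈C , ¬wc) ← maximumClique⇒nonNeighbour maximum w∉C
        let (x , wx) = walk⇒neighbour (λ { refl → w∉C c∈C }) (connected w c)
            x≢c = λ x≡c → ¬wc (subst (Adj w) x≡c wx)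
            xc = proj₁ maximum (∉C-neighbour⇒∈C w∉C wx) c∈C x≢c
            (t , t∈D , w≢t , p , p≤3) = memberWithin3 (c ∈? D) c∈C ¬wc wx xc
        convex⇒neighbour-toward convex w∈D t∈D w≢t p p≤3
        where
        memberWithin3 : ∀ {x c} → Dec (c ∈ D) → c ∈ C → ¬ Adj w c → Adj w x → Adj x c →
                        ∃[ t ] (t ∈ D × w ≢ t × ∃[ p ] (len G {w} {t} p ≤ 3))
        memberWithin3 {c = c} (yes c∈D) c∈C _ wx xc =
          c , c∈D , (λ { refl → w∉C c∈C }) , wx ∷ (xc ∷ [ c ]) , s≤s (s≤s z≤n)
        memberWithin3 {c = c} (no c∉D) _ ¬wc wx xc with dominating c
        ... | inj₁ c∈D             = ⊥-elim (c∉D c∈D)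
        ... | inj₂ (u , u∈D , cu) =
          u , u∈D , (λ { refl → ¬wc (Adj-sym cu) }) , wx ∷ (xc ∷ (cu ∷ [ u ])) , ≤-refl

      D∩C-dominating : ∀ {x₀} → x₀ ∈ D → x₀ ∈ C → DoubleNegation (IsDominating G (D ∩ C))
      D∩C-dominating {x₀} x₀∈D x₀∈C = ¬¬-∀-Fin dominated
        where
        Dominated : Fin n → Set
        Dominated t = t ∈ D ∩ C ⊎ ∃[ u ] (u ∈ D ∩ C × Adj t u)
        neighbourInD : ∀ {t u} → t ∉ C → u ∈ D → Adj t u → Dominated t
        neighbourInD t∉C u∈D tu = inj₂ (_ , x∈p∩q⁺ (u∈D , ∉C-neighbour⇒∈C t∉C tu) , tu)
        dominated : ∀ t → DoubleNegation (Dominated t)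
        dominated t with t ∈? C | t ∈? D
        ... | yes t∈C | yes t∈D = return (inj₁ (x∈p∩q⁺ (t∈D , t∈C)))
        ... | yes t∈C | no  t∉D =
          return (inj₂ (x₀ , x∈p∩q⁺ (x₀∈D , x₀∈C) , proj₁ maximum t∈C x₀∈C λ { refl → t∉D x₀∈D }))
        ... | no  t∉C | yes t∈D = do
          (u , u∈D , tu) ← ∈D∉C⇒neighbour∈D t∈D t∉C
          return (neighbourInD t∉C u∈D tu)
        ... | no  t∉C | no  t∉D with dominating t
        ...   | inj₁ t∈D            = ⊥-elim (t∉D t∈D)
        ...   | inj₂ (u , u∈D , tu) = return (neighbourInD t∉C u∈D tu)

      D∩C-convexDominating : ∀ {w} → w ∈ D → w ∉ C →
                             DoubleNegation (IsConvexDominating G (D ∩ C))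
      D∩C-convexDominating w∈D w∉C = withConvexity <$> D∩C-dominates
        where
        withConvexity : IsDominating G (D ∩ C) → IsConvexDominating G (D ∩ C)
        withConvexity = clique⇒convex (clique-⊆ (p∩q⊆q D C) (proj₁ maximum)) ,_
        D∩C-dominates : DoubleNegation (IsDominating G (D ∩ C))
        D∩C-dominates = do
          (x₀ , x₀∈D , wx₀) ← ∈D∉C⇒neighbour∈D w∈D w∉C
          D∩C-dominating x₀∈D (∉C-neighbour⇒∈C w∉C wx₀)

mainTheorem5 : ∀ {n : ℕ} (G : Graph n) → Connected G → IsSplit G →
               (C : Subset n) → IsMaximumClique G C → IsIndependent G (∁ C) →
               (D : Subset n) → IsMinimalConvexDominating G D → D ⊆ C
mainTheorem5 G connected _ C maximum independent D ((convex , dominating) , minimal) {w} w∈D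
  with w ∈? C
... | yes w∈C = w∈C
... | no  w∉C = ⊥-elim (D∩C-convexDominating G independent connected maximum convex dominating
                          w∈D w∉C (minimal (D ∩ C) D∩C⊂D))
  where
  D∩C⊂D : D ∩ C ⊂ D
  D∩C⊂D = p∩q⊆p D C , w , w∈D , λ w∈D∩C → w∉C (proj₂ (x∈p∩q⁻ D C w∈D∩C))
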